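{- Let $K=\mathbb{Q}(\zeta_5)$ be embedded in $\mathbb{C}$, where $\sqrt5>0$ and $\sqrt{ -5-2\sqrt5}=i\sqrt{5+2\sqrt5}$, $\sqrt{ -5+2\sqrt5}=i\sqrt{5-2\sqrt5}$ (positive imaginary parts). Let $p$ be a prime and let $\pi\in K$ be a Weil $p$-number of the form $$\pi=\frac14\left(A+B\sqrt5+C\sqrt{ -5-2\sqrt5}+D\sqrt{ -5+2\sqrt5}\right),\qquad A,B,C,D\in\mathbb{Z}.$$ Then $$\operatorname{disc}(\pi)=\frac{125}{16}\,p^2B^4\,(C^2-4CD-D^2)^2 .$$
   Context: A Weil $p$-number in a CM field $K$ is an algebraic integer $\pi\in K$ such that $|\phi(\pi)|=\sqrt p$ for every embedding $\phi:K\to\mathbb{C}$; in particular $\pi\bar\pi=p$. For $\pi\in K$ with $[K:\mathbb{Q}]=4$, $\operatorname{disc}(\pi)=\prod_{i<j}(\pi_i-\pi_j)^2$, where $\pi_1,\dots,\pi_4$ are the images of $\pi$ under the four embeddings of $K$ into $\mathbb{C}$. -}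

module Defs where

open import Data.Nat using (ℕ)
open import Data.Integer using (ℤ; +_)
open import Data.Rational using (ℚ; _+_; _*_; -_; _-_; 0ℚ; 1ℚ; _/_)
open import Data.List using (List; foldl)
open import Data.Product using (Σ)
open import Relation.Binary.PropositionalEquality using (_≡_)

-- Elements of K = ℚ(ζ₅) in the ℚ-basis 1, s, a, b where (in ℂ)
--   s = √5 > 0,  a = √(-5-2√5) = i√(5+2√5),  b = √(-5+2√5) = i√(5-2√5).
-- Relations (valid for these complex numbers):
--   s² = 5, a² = -5-2s, b² = -5+2s, ab = -s, sa = 2a+b, sb = a-2b.
record K : Set where
  constructor mkK
  field
    c0 c1 c2 c3 : ℚ
open K public

ι : ℚ → K
ι q = mkK q 0ℚ 0ℚ 0ℚ

ιℤ : ℤ → K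
ιℤ z = ι (z / 1)

ιℕ : ℕ → K
ιℕ n = ιℤ (+ n)

0K 1K : K
0K = ι 0ℚ
1K = ι 1ℚ

infixl 6 _+K_ _-K_
infixl 7 _*K_

_+K_ : K → K → K
mkK x0 x1 x2 x3 +K mkK y0 y1 y2 y3 = mkK (x0 + y0) (x1 + y1) (x2 + y2) (x3 + y3)

-K_ : K → K
-K mkK x0 x1 x2 x3 = mkK (- x0) (- x1) (- x2) (- x3)

_-K_ : K → K → K
x -K y = x +K (-K y)

q : ℤ → ℚ
q z = z / 1

_*K_ : K → K → K
mkK x0 x1 x2 x3 *K mkK y0 y1 y2 y3 = mkK
  (x0 * y0 + q (+ 5) * (x1 * y1) - q (+ 5) * (x2 * y2) - q (+ 5) * (x3 * y3))
  (x0 * y1 + x1 * y0 - q (+ 2) * (x2 * y2) + q (+ 2) * (x3 * y3) - (x2 * y3 + x3 * y2))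
  (x0 * y2 + x2 * y0 + q (+ 2) * (x1 * y2 + x2 * y1) + (x1 * y3 + x3 * y1))
  (x0 * y3 + x3 * y0 + (x1 * y2 + x2 * y1) - q (+ 2) * (x1 * y3 + x3 * y1))

conj : K → K
conj (mkK x0 x1 x2 x3) = mkK x0 x1 (- x2) (- x3)

-- The generator τ of Gal(K/ℚ) ≅ ℤ/4:  s ↦ -s, a ↦ b, b ↦ -a  (τ² = conj).
τ : K → K
τ (mkK x0 x1 x2 x3) = mkK x0 (- x1) (- x3) x2

-- The four embeddings K → ℂ are ι∘σ for σ ∈ Gal(K/ℚ) = {id, τ, τ², τ³}.
-- We index them by 0..3: σ k = τ^k.
data Idx : Set where
  e0 e1 e2 e3 : Idx

σ : Idx → K → K
σ e0 x = x
σ e1 x = τ x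
σ e2 x = τ (τ x)
σ e3 x = τ (τ (τ x))

-- Algebraic integer: root of a monic polynomial with integer coefficients.
-- For cs = [c_{n-1}, …, c_0] the monic polynomial is X^n + c_{n-1} X^{n-1} + … + c_0,
-- evaluated by Horner's rule.
evalMonic : List ℤ → K → K
evalMonic cs x = foldl (λ acc c → acc *K x +K ιℤ c) 1K cs

IsAlgebraicInteger : K → Set
IsAlgebraicInteger x = Σ (List ℤ) (λ cs → evalMonic cs x ≡ 0K)

-- Weil p-number: algebraic integer with |φ(π)|² = p for every embedding φ.
-- For φ = ι∘σ we have |φ(π)|² = ι(σ π) · conj(ι(σ π)) = ι(σ π · conj(σ π)).
IsWeilNumber : ℕ → K → Set
IsWeilNumber p π =
  Σ (IsAlgebraicInteger π) (λ _ → (i : Idx) → σ i π *K conj (σ i π) ≡ ιℕ p)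

sq : K → K
sq x = x *K x

disc : K → K
disc π =
  let p0 = σ e0 π ; p1 = σ e1 π ; p2 = σ e2 π ; p3 = σ e3 π in
  sq (p0 -K p1) *K sq (p0 -K p2) *K sq (p0 -K p3)
    *K sq (p1 -K p2) *K sq (p1 -K p3) *K sq (p2 -K p3)

piOf : ℤ → ℤ → ℤ → ℤ → K
piOf A B C D = mkK (A / 4) (B / 4) (C / 4) (D / 4)

{-# OPTIONS --safe #-}
-- Write π = (a, b, c, d) in the coordinates 1, √5, √(-5-2√5), √(-5+2√5) and πᵢ = σᵢ(π). The
-- six differences πᵢ - πⱼ pair up into elements of the real subfield ℚ(√5):
--   (π₀ - π₁)(π₂ - π₃) = U + V√5,  (π₁ - π₂)(π₀ - π₃) = -U + V√5,  (π₀ - π₂)(π₁ - π₃) = W√5,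
-- with U = 10(2b² + c² + d²), V = -2Q, W = -4Q and Q = c² - 4cd - d², so that
-- disc(π) = (U² - 5V²)² · 5W². Comparing the rational and √5-parts of ππ̄ = p shows that the
-- norm U² - 5V² equals 80b²p; hence disc(π) = 80 (80b²p)² Q², and a = A/4, …, d = D/4 gives
-- the formula.
module Submission where

open import Defs
open import Data.Nat using (ℕ)
open import Data.Nat.Primality using (Prime)
open import Data.Integer using (ℤ; +_; _*_; _-_; _^_)
open import Data.Rational using (_/_)
open import Relation.Binary.PropositionalEquality using (_≡_)

open import Algebra.Bundles using (CommutativeMonoid)
open import Data.Integer.Tactic.RingSolver using (solve-∀)
open import Data.List using (_∷_; [])
open import Data.Maybe using (Maybe; just; nothing)
open import Data.Nat using (suc)
open import Data.Nat.Properties using (+-identityʳ)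
open import Data.Product using (_×_; _,_; proj₁; proj₂)
open import Function using (_∋_)
open import Level using (Level; 0ℓ)
open import Relation.Binary.PropositionalEquality
  using (refl; sym; trans; cong; cong₂; subst₂; isEquivalence; module ≡-Reasoning)
open import Relation.Nullary using (yes; no)
open import Tactic.RingSolver using (solve)
open import Tactic.RingSolver.Core.AlmostCommutativeRing
  using (AlmostCommutativeRing; fromCommutativeRing)
import Data.Integer as ℤ
open import Data.Rational as ℚ using (ℚ; 0ℚ; toℚᵘ)
open import Data.Rational.Properties as ℚ
  using (+-*-commutativeRing; _≟_; toℚᵘ-injective; toℚᵘ-fromℚᵘ;
         toℚᵘ-homo-+; toℚᵘ-homo-*; toℚᵘ-homo‿-)
open import Data.Rational.Unnormalised as ℚᵘ using (mkℚᵘ; *≡*)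
open import Data.Rational.Unnormalised.Properties
  using (≃-trans; ≃-sym; +-cong; *-cong; -‿cong)
open import Algebra.Properties.Group ℚ.+-0-group using (⁻¹-involutive)

ℚ-ring : AlmostCommutativeRing 0ℓ 0ℓ
ℚ-ring = fromCommutativeRing +-*-commutativeRing 0≟
  where
  0≟ : (x : ℚ) → Maybe (0ℚ ≡ x)
  0≟ x with 0ℚ ≟ x
  ... | yes 0≡x = just 0≡x
  ... | no _    = nothing

open AlmostCommutativeRing ℚ-ring using () renaming (_^_ to _^ℚ_)

mkK-cong : ∀ {x₀ x₁ x₂ x₃ y₀ y₁ y₂ y₃} → x₀ ≡ y₀ → x₁ ≡ y₁ → x₂ ≡ y₂ → x₃ ≡ y₃ →
           mkK x₀ x₁ x₂ x₃ ≡ mkK y₀ y₁ y₂ y₃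
mkK-cong refl refl refl refl = refl

-- The reflective ring solver does not unfold definitions: a coordinate of a product is a ring
-- expression only when both factors are literally of the form mkK …. Goals are brought into
-- that shape by ascribing (∋) the constructor form, or by first computing inner products.

*K-comm : ∀ x y → x *K y ≡ y *K x
*K-comm (mkK x₀ x₁ x₂ x₃) (mkK y₀ y₁ y₂ y₃) =
  mkK-cong (solve vs ℚ-ring) (solve vs ℚ-ring) (solve vs ℚ-ring) (solve vs ℚ-ring)
  where vs = x₀ ∷ x₁ ∷ x₂ ∷ x₃ ∷ y₀ ∷ y₁ ∷ y₂ ∷ y₃ ∷ []

*K-assoc : ∀ x y z → (x *K y) *K z ≡ x *K (y *K z)
*K-assoc x@(mkK x₀ x₁ x₂ x₃) y@(mkK y₀ y₁ y₂ y₃) z@(mkK z₀ z₁ z₂ z₃) =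
  subst₂ _≡_ (cong (_*K z) (sym xy)) (cong (x *K_) (sym yz))
    (mkK-cong (solve vs ℚ-ring) (solve vs ℚ-ring) (solve vs ℚ-ring) (solve vs ℚ-ring))
  where
  vs = x₀ ∷ x₁ ∷ x₂ ∷ x₃ ∷ y₀ ∷ y₁ ∷ y₂ ∷ y₃ ∷ z₀ ∷ z₁ ∷ z₂ ∷ z₃ ∷ []
  xy : x *K y ≡ mkK _ _ _ _
  xy = refl
  yz : y *K z ≡ mkK _ _ _ _
  yz = refl

*K-identityˡ : ∀ x → 1K *K x ≡ x
*K-identityˡ (mkK x₀ x₁ x₂ x₃) =
  mkK-cong (solve vs ℚ-ring) (solve vs ℚ-ring) (solve vs ℚ-ring) (solve vs ℚ-ring)
  where vs = x₀ ∷ x₁ ∷ x₂ ∷ x₃ ∷ []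

*K-identityʳ : ∀ x → x *K 1K ≡ x
*K-identityʳ x = trans (*K-comm x 1K) (*K-identityˡ x)

*K-commutativeMonoid : CommutativeMonoid 0ℓ 0ℓ
*K-commutativeMonoid = record
  { Carrier = K
  ; _≈_ = _≡_
  ; _∙_ = _*K_
  ; ε = 1K
  ; isCommutativeMonoid = record
    { isMonoid = record
      { isSemigroup = record
        { isMagma = record { isEquivalence = isEquivalence ; ∙-cong = cong₂ _*K_ }
        ; assoc = *K-assoc
        }
      ; identity = *K-identityˡ , *K-identityʳ
      }
    ; comm = *K-comm
    }
  }

module _ {c ℓ : Level} (M : CommutativeMonoid c ℓ) where
  open CommutativeMonoid M using (_≈_; _∙_) renaming (refl to ≈-refl)
  import Algebra.Solver.CommutativeMonoid M as CM
  open CM using (_⊜_; _⊕_)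

  regroup-six-squares : ∀ x₀₁ x₀₂ x₀₃ x₁₂ x₁₃ x₂₃ →
    (x₀₁ ∙ x₀₁) ∙ (x₀₂ ∙ x₀₂) ∙ (x₀₃ ∙ x₀₃) ∙ (x₁₂ ∙ x₁₂) ∙ (x₁₃ ∙ x₁₃) ∙ (x₂₃ ∙ x₂₃)
      ≈ ((x₀₁ ∙ x₂₃) ∙ (x₁₂ ∙ x₀₃)) ∙ ((x₀₁ ∙ x₂₃) ∙ (x₁₂ ∙ x₀₃)) ∙ ((x₀₂ ∙ x₁₃) ∙ (x₀₂ ∙ x₁₃))
  regroup-six-squares = CM.solve 6 (λ x₀₁ x₀₂ x₀₃ x₁₂ x₁₃ x₂₃ →
    (((((x₀₁ ⊕ x₀₁) ⊕ (x₀₂ ⊕ x₀₂)) ⊕ (x₀₃ ⊕ x₀₃)) ⊕ (x₁₂ ⊕ x₁₂)) ⊕ (x₁₃ ⊕ x₁₃)) ⊕ (x₂₃ ⊕ x₂₃)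
      ⊜ (((x₀₁ ⊕ x₂₃) ⊕ (x₁₂ ⊕ x₀₃)) ⊕ ((x₀₁ ⊕ x₂₃) ⊕ (x₁₂ ⊕ x₀₃))) ⊕ ((x₀₂ ⊕ x₁₃) ⊕ (x₀₂ ⊕ x₁₃)))
    ≈-refl

pairing-squares : K → K → K → K → K
pairing-squares x₀ x₁ x₂ x₃ =
  sq (((x₀ -K x₁) *K (x₂ -K x₃)) *K ((x₁ -K x₂) *K (x₀ -K x₃))) *K sq ((x₀ -K x₂) *K (x₁ -K x₃))

-- Instantiated at variables, where the conversion between sq and _∙_ is cheap; checking the
-- generic lemma directly at the differences of conjugates would unfold the whole product.
*K-regroup-six-squares : ∀ x₀₁ x₀₂ x₀₃ x₁₂ x₁₃ x₂₃ →
  sq x₀₁ *K sq x₀₂ *K sq x₀₃ *K sq x₁₂ *K sq x₁₃ *K sq x₂₃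
    ≡ sq ((x₀₁ *K x₂₃) *K (x₁₂ *K x₀₃)) *K sq (x₀₂ *K x₁₃)
*K-regroup-six-squares = regroup-six-squares *K-commutativeMonoid

disc≡pairing-squares : ∀ π → disc π ≡ pairing-squares (σ e0 π) (σ e1 π) (σ e2 π) (σ e3 π)
disc≡pairing-squares π = *K-regroup-six-squares
  (σ e0 π -K σ e1 π) (σ e0 π -K σ e2 π) (σ e0 π -K σ e3 π)
  (σ e1 π -K σ e2 π) (σ e1 π -K σ e3 π) (σ e2 π -K σ e3 π)

ι-homo-*K : ∀ x y → ι x *K ι y ≡ ι (x ℚ.* y)
ι-homo-*K x y = (mkK x 0ℚ 0ℚ 0ℚ *K mkK y 0ℚ 0ℚ 0ℚ ≡ _) ∋
  mkK-cong (solve vs ℚ-ring) (solve vs ℚ-ring) (solve vs ℚ-ring) (solve vs ℚ-ring)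
  where vs = x ∷ y ∷ []

ℚ√5-conjugates : ∀ u v →
  mkK u v 0ℚ 0ℚ *K mkK (ℚ.- u) v 0ℚ 0ℚ ≡ ι (ℚ.- (u ℚ.* u ℚ.- q (+ 5) ℚ.* (v ℚ.* v)))
ℚ√5-conjugates u v =
  mkK-cong (solve vs ℚ-ring) (solve vs ℚ-ring) (solve vs ℚ-ring) (solve vs ℚ-ring)
  where vs = u ∷ v ∷ []

√5-square : ∀ w → sq (mkK 0ℚ w 0ℚ 0ℚ) ≡ ι (q (+ 5) ℚ.* (w ℚ.* w))
√5-square w =
  mkK-cong (solve vs ℚ-ring) (solve vs ℚ-ring) (solve vs ℚ-ring) (solve vs ℚ-ring)
  where vs = w ∷ []

pairing-squares-in-ℚ√5 : ∀ {n} u v w → u ℚ.* u ℚ.- q (+ 5) ℚ.* (v ℚ.* v) ≡ n →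
  sq (mkK u v 0ℚ 0ℚ *K mkK (ℚ.- u) v 0ℚ 0ℚ) *K sq (mkK 0ℚ w 0ℚ 0ℚ)
    ≡ ι (n ℚ.* n ℚ.* (q (+ 5) ℚ.* (w ℚ.* w)))
pairing-squares-in-ℚ√5 {n} u v w N≡n =
  let N = u ℚ.* u ℚ.- q (+ 5) ℚ.* (v ℚ.* v)
      W = q (+ 5) ℚ.* (w ℚ.* w)
  in begin
      sq (mkK u v 0ℚ 0ℚ *K mkK (ℚ.- u) v 0ℚ 0ℚ) *K sq (mkK 0ℚ w 0ℚ 0ℚ)
        ≡⟨ cong₂ (λ x y → sq x *K y) (ℚ√5-conjugates u v) (√5-square w) ⟩
      sq (ι (ℚ.- N)) *K ι W
        ≡⟨ cong (_*K ι W) (ι-homo-*K (ℚ.- N) (ℚ.- N)) ⟩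
      ι (ℚ.- N ℚ.* ℚ.- N) *K ι W
        ≡⟨ ι-homo-*K (ℚ.- N ℚ.* ℚ.- N) W ⟩
      ι (ℚ.- N ℚ.* ℚ.- N ℚ.* W)
        ≡⟨ cong (λ x → ι (ℚ.- x ℚ.* ℚ.- x ℚ.* W)) N≡n ⟩
      ι (ℚ.- n ℚ.* ℚ.- n ℚ.* W)
        ≡⟨ cong ι (solve (n ∷ w ∷ []) ℚ-ring) ⟩
      ι (n ℚ.* n ℚ.* W) ∎
  where open ≡-Reasoning

module Conjugates (a b c d : ℚ) where
  π₀ π₁ π₂ π₃ : K
  π₀ = mkK a b c d
  π₁ = mkK a (ℚ.- b) (ℚ.- d) c
  π₂ = mkK a b (ℚ.- c) (ℚ.- d)
  π₃ = mkK a (ℚ.- b) d (ℚ.- c)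

  σ₂π₀ : σ e2 π₀ ≡ π₂
  σ₂π₀ = mkK-cong refl (⁻¹-involutive b) refl refl

  σ₃π₀ : σ e3 π₀ ≡ π₃
  σ₃π₀ = mkK-cong refl (cong ℚ.-_ (⁻¹-involutive b)) (⁻¹-involutive d) refl

  pairings :
    let U = q (+ 10) ℚ.* (q (+ 2) ℚ.* (b ℚ.* b) ℚ.+ c ℚ.* c ℚ.+ d ℚ.* d)
        Q = c ℚ.* c ℚ.- q (+ 4) ℚ.* c ℚ.* d ℚ.- d ℚ.* d
    in (π₀ -K π₁) *K (π₂ -K π₃) ≡ mkK U (ℚ.- (q (+ 2) ℚ.* Q)) 0ℚ 0ℚ
     × (π₁ -K π₂) *K (π₀ -K π₃) ≡ mkK (ℚ.- U) (ℚ.- (q (+ 2) ℚ.* Q)) 0ℚ 0ℚ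
     × (π₀ -K π₂) *K (π₁ -K π₃) ≡ mkK 0ℚ (ℚ.- (q (+ 4) ℚ.* Q)) 0ℚ 0ℚ
  pairings =
    ((mkK (a ℚ.- a) (b ℚ.- ℚ.- b) (c ℚ.- ℚ.- d) (d ℚ.- c)
        *K mkK (a ℚ.- a) (b ℚ.- ℚ.- b) (ℚ.- c ℚ.- d) (ℚ.- d ℚ.- ℚ.- c) ≡ _) ∋
       mkK-cong (solve vs ℚ-ring) (solve vs ℚ-ring) (solve vs ℚ-ring) (solve vs ℚ-ring)) ,
    ((mkK (a ℚ.- a) (ℚ.- b ℚ.- b) (ℚ.- d ℚ.- ℚ.- c) (c ℚ.- ℚ.- d)
        *K mkK (a ℚ.- a) (b ℚ.- ℚ.- b) (c ℚ.- d) (d ℚ.- ℚ.- c) ≡ _) ∋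
       mkK-cong (solve vs ℚ-ring) (solve vs ℚ-ring) (solve vs ℚ-ring) (solve vs ℚ-ring)) ,
    ((mkK (a ℚ.- a) (b ℚ.- b) (c ℚ.- ℚ.- c) (d ℚ.- ℚ.- d)
        *K mkK (a ℚ.- a) (ℚ.- b ℚ.- ℚ.- b) (ℚ.- d ℚ.- d) (c ℚ.- ℚ.- c) ≡ _) ∋
       mkK-cong (solve vs ℚ-ring) (solve vs ℚ-ring) (solve vs ℚ-ring) (solve vs ℚ-ring))
    where vs = a ∷ b ∷ c ∷ d ∷ []

  π₀-times-conj : π₀ *K conj π₀
    ≡ mkK (a ℚ.* a ℚ.+ q (+ 5) ℚ.* (b ℚ.* b ℚ.+ c ℚ.* c ℚ.+ d ℚ.* d))
          (q (+ 2) ℚ.* (a ℚ.* b ℚ.+ c ℚ.* c ℚ.+ c ℚ.* d ℚ.- d ℚ.* d)) 0ℚ 0ℚ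
  π₀-times-conj = (mkK a b c d *K mkK a b (ℚ.- c) (ℚ.- d) ≡ _) ∋
    mkK-cong (solve vs ℚ-ring) (solve vs ℚ-ring) (solve vs ℚ-ring) (solve vs ℚ-ring)
    where vs = a ∷ b ∷ c ∷ d ∷ []

  pairing-norm : ∀ {r} → π₀ *K conj π₀ ≡ ι r →
    let U = q (+ 10) ℚ.* (q (+ 2) ℚ.* (b ℚ.* b) ℚ.+ c ℚ.* c ℚ.+ d ℚ.* d)
        V = ℚ.- (q (+ 2) ℚ.* (c ℚ.* c ℚ.- q (+ 4) ℚ.* c ℚ.* d ℚ.- d ℚ.* d))
    in U ℚ.* U ℚ.- q (+ 5) ℚ.* (V ℚ.* V) ≡ q (+ 80) ℚ.* (b ℚ.* b) ℚ.* r
  pairing-norm {r} ππ̄≡r =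
    let U = q (+ 10) ℚ.* (q (+ 2) ℚ.* (b ℚ.* b) ℚ.+ c ℚ.* c ℚ.+ d ℚ.* d)
        V = ℚ.- (q (+ 2) ℚ.* (c ℚ.* c ℚ.- q (+ 4) ℚ.* c ℚ.* d ℚ.- d ℚ.* d))
        n = a ℚ.* a ℚ.+ q (+ 5) ℚ.* (b ℚ.* b ℚ.+ c ℚ.* c ℚ.+ d ℚ.* d)
        e = q (+ 2) ℚ.* (a ℚ.* b ℚ.+ c ℚ.* c ℚ.+ c ℚ.* d ℚ.- d ℚ.* d)
        t = q (+ 40) ℚ.* (c ℚ.* c ℚ.+ c ℚ.* d ℚ.- d ℚ.* d ℚ.- a ℚ.* b)
    in begin
      U ℚ.* U ℚ.- q (+ 5) ℚ.* (V ℚ.* V)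
        ≡⟨ solve (a ∷ b ∷ c ∷ d ∷ []) ℚ-ring ⟩
      q (+ 80) ℚ.* (b ℚ.* b) ℚ.* n ℚ.+ t ℚ.* e
        ≡⟨ cong₂ (λ x y → q (+ 80) ℚ.* (b ℚ.* b) ℚ.* x ℚ.+ t ℚ.* y)
                 (cong c0 norm≡r) (cong c1 norm≡r) ⟩
      q (+ 80) ℚ.* (b ℚ.* b) ℚ.* r ℚ.+ t ℚ.* 0ℚ
        ≡⟨ solve (a ∷ b ∷ c ∷ d ∷ r ∷ []) ℚ-ring ⟩
      q (+ 80) ℚ.* (b ℚ.* b) ℚ.* r ∎
    where
    open ≡-Reasoning
    norm≡r = trans (sym π₀-times-conj) ππ̄≡r

  disc-formula : ∀ {r} → π₀ *K conj π₀ ≡ ι r →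
    let m = q (+ 80) ℚ.* (b ℚ.* b) ℚ.* r
        Q = c ℚ.* c ℚ.- q (+ 4) ℚ.* c ℚ.* d ℚ.- d ℚ.* d
    in disc π₀ ≡ ι (q (+ 80) ℚ.* (m ℚ.* m) ℚ.* (Q ℚ.* Q))
  disc-formula {r} ππ̄≡r =
    let U = q (+ 10) ℚ.* (q (+ 2) ℚ.* (b ℚ.* b) ℚ.+ c ℚ.* c ℚ.+ d ℚ.* d)
        Q = c ℚ.* c ℚ.- q (+ 4) ℚ.* c ℚ.* d ℚ.- d ℚ.* d
        V = ℚ.- (q (+ 2) ℚ.* Q)
        W = ℚ.- (q (+ 4) ℚ.* Q)
        m = q (+ 80) ℚ.* (b ℚ.* b) ℚ.* r
    in begin
      disc π₀
        ≡⟨ disc≡pairing-squares π₀ ⟩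
      pairing-squares (σ e0 π₀) (σ e1 π₀) (σ e2 π₀) (σ e3 π₀)
        ≡⟨ cong₂ (pairing-squares π₀ π₁) σ₂π₀ σ₃π₀ ⟩
      pairing-squares π₀ π₁ π₂ π₃
        ≡⟨ cong₂ (λ x y → sq x *K sq y) (cong₂ _*K_ p₀₁₂₃ p₁₂₀₃) p₀₂₁₃ ⟩
      sq (mkK U V 0ℚ 0ℚ *K mkK (ℚ.- U) V 0ℚ 0ℚ) *K sq (mkK 0ℚ W 0ℚ 0ℚ)
        ≡⟨ pairing-squares-in-ℚ√5 U V W (pairing-norm ππ̄≡r) ⟩
      ι (m ℚ.* m ℚ.* (q (+ 5) ℚ.* (W ℚ.* W)))
        ≡⟨ cong ι (solve (b ∷ c ∷ d ∷ r ∷ []) ℚ-ring) ⟩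
      ι (q (+ 80) ℚ.* (m ℚ.* m) ℚ.* (Q ℚ.* Q)) ∎
    where
    open ≡-Reasoning
    p₀₁₂₃ = proj₁ pairings
    p₁₂₀₃ = proj₁ (proj₂ pairings)
    p₀₂₁₃ = proj₂ (proj₂ pairings)

-- q z = z / 1 is normalised by a gcd computation; its homomorphism properties are proved on
-- unnormalised representatives, where q z is the fraction z/1 on the nose.
toℚᵘ-q : ∀ z → toℚᵘ (q z) ℚᵘ.≃ mkℚᵘ z 0
toℚᵘ-q z = toℚᵘ-fromℚᵘ (mkℚᵘ z 0)

q-homo-+ : ∀ x y → q (x ℤ.+ y) ≡ q x ℚ.+ q y
q-homo-+ x y = toℚᵘ-injective (≃-trans (toℚᵘ-q (x ℤ.+ y))
  (≃-sym (≃-trans (toℚᵘ-homo-+ (q x) (q y)) (≃-trans (+-cong (toℚᵘ-q x) (toℚᵘ-q y)) (*≡* (ℤ-identity x y))))))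
  where
  ℤ-identity : ∀ x y → (x * + 1 ℤ.+ y * + 1) * + 1 ≡ (x ℤ.+ y) * + 1
  ℤ-identity = solve-∀

q-homo-* : ∀ x y → q (x * y) ≡ q x ℚ.* q y
q-homo-* x y = toℚᵘ-injective (≃-trans (toℚᵘ-q (x * y))
  (≃-sym (≃-trans (toℚᵘ-homo-* (q x) (q y)) (*-cong (toℚᵘ-q x) (toℚᵘ-q y)))))

q-homo‿- : ∀ x → q (ℤ.- x) ≡ ℚ.- q x
q-homo‿- x = toℚᵘ-injective (≃-trans (toℚᵘ-q (ℤ.- x))
  (≃-sym (≃-trans (toℚᵘ-homo‿- (q x)) (-‿cong (toℚᵘ-q x)))))

q-homo-- : ∀ x y → q (x - y) ≡ q x ℚ.- q y
q-homo-- x y = trans (q-homo-+ x (ℤ.- y)) (cong (q x ℚ.+_) (q-homo‿- y))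

q-homo-^ : ∀ x n → q (x ^ n) ≡ q x ^ℚ n
q-homo-^ x 0 = refl
q-homo-^ x 1 = trans (q-homo-* x (+ 1)) (ℚ.*-identityʳ (q x))
q-homo-^ x (suc (suc n)) =
  trans (q-homo-* x (x ^ suc n)) (trans (cong (q x ℚ.*_) (q-homo-^ x (suc n))) (ℚ.*-comm (q x) _))

/-as-* : ∀ i n → i / suc n ≡ q i ℚ.* (+ 1 / suc n)
/-as-* i n = toℚᵘ-injective (≃-trans (toℚᵘ-fromℚᵘ (mkℚᵘ i n))
  (≃-sym (≃-trans (toℚᵘ-homo-* (q i) (+ 1 / suc n))
    (≃-trans (*-cong (toℚᵘ-q i) (toℚᵘ-fromℚᵘ (mkℚᵘ (+ 1) n)))
      (*≡* (trans (ℤ-identity i (+ suc n)) (cong (λ m → i * + suc m) (sym (+-identityʳ n)))))))))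
  where
  ℤ-identity : ∀ i m → (i * + 1) * m ≡ i * m
  ℤ-identity = solve-∀

quarter-scaling : ∀ {b c d} β γ δ ρ →
  b ≡ β ℚ.* (+ 1 / 4) → c ≡ γ ℚ.* (+ 1 / 4) → d ≡ δ ℚ.* (+ 1 / 4) →
  let m = q (+ 80) ℚ.* (b ℚ.* b) ℚ.* ρ
      Q = c ℚ.* c ℚ.- q (+ 4) ℚ.* c ℚ.* d ℚ.- d ℚ.* d
  in q (+ 80) ℚ.* (m ℚ.* m) ℚ.* (Q ℚ.* Q)
     ≡ q (+ 125) ℚ.* ρ ^ℚ 2 ℚ.* β ^ℚ 4
         ℚ.* (γ ℚ.* γ ℚ.- q (+ 4) ℚ.* γ ℚ.* δ ℚ.- δ ℚ.* δ) ^ℚ 2 ℚ.* (+ 1 / 16)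
quarter-scaling β γ δ ρ refl refl refl = solve (β ∷ γ ∷ δ ∷ ρ ∷ []) ℚ-ring

q-homo-formula : ∀ (p : ℕ) B C D →
  q ((+ 125) * ((+ p) ^ 2) * (B ^ 4) * ((C * C - (+ 4) * C * D - D * D) ^ 2))
    ≡ q (+ 125) ℚ.* q (+ p) ^ℚ 2 ℚ.* q B ^ℚ 4
        ℚ.* (q C ℚ.* q C ℚ.- q (+ 4) ℚ.* q C ℚ.* q D ℚ.- q D ℚ.* q D) ^ℚ 2
q-homo-formula p B C D =
  trans (q-homo-* ((+ 125) * ((+ p) ^ 2) * (B ^ 4)) (Q ^ 2)) (cong₂ ℚ._*_
    (trans (q-homo-* ((+ 125) * ((+ p) ^ 2)) (B ^ 4)) (cong₂ ℚ._*_
      (trans (q-homo-* (+ 125) ((+ p) ^ 2)) (cong (q (+ 125) ℚ.*_) (q-homo-^ (+ p) 2)))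
      (q-homo-^ B 4)))
    (trans (q-homo-^ Q 2) (cong (_^ℚ 2) q-homo-Q)))
  where
  Q = C * C - (+ 4) * C * D - D * D
  q-homo-Q : q Q ≡ q C ℚ.* q C ℚ.- q (+ 4) ℚ.* q C ℚ.* q D ℚ.- q D ℚ.* q D
  q-homo-Q = trans (q-homo-- (C * C - (+ 4) * C * D) (D * D)) (cong₂ ℚ._-_
    (trans (q-homo-- (C * C) ((+ 4) * C * D)) (cong₂ ℚ._-_ (q-homo-* C C)
      (trans (q-homo-* ((+ 4) * C) D) (cong (ℚ._* q D) (q-homo-* (+ 4) C)))))
    (q-homo-* D D))

mainTheorem2 : (p : ℕ) (A B C D : ℤ) → Prime p → IsWeilNumber p (piOf A B C D) →
    disc (piOf A B C D)
      ≡ ι (((+ 125) * ((+ p) ^ 2) * (B ^ 4) * ((C * C - (+ 4) * C * D - D * D) ^ 2)) / 16)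
mainTheorem2 p A B C D _ (_ , |σπ|²≡p) = begin
  disc (piOf A B C D)
    ≡⟨ disc-piOf ⟩
  disc π₀
    ≡⟨ disc-formula ππ̄≡p ⟩
  ι _
    ≡⟨ cong ι (quarter-scaling (q B) (q C) (q D) (q (+ p)) (/-as-* B 3) (/-as-* C 3) (/-as-* D 3)) ⟩
  ι _
    ≡⟨ cong (λ x → ι (x ℚ.* (+ 1 / 16))) (sym (q-homo-formula p B C D)) ⟩
  ι (q Z ℚ.* (+ 1 / 16))
    ≡⟨ cong ι (sym (/-as-* Z 15)) ⟩
  ι (Z / 16) ∎
  where
  open ≡-Reasoning
  open Conjugates (A / 4) (B / 4) (C / 4) (D / 4)
  Z = (+ 125) * ((+ p) ^ 2) * (B ^ 4) * ((C * C - (+ 4) * C * D - D * D) ^ 2)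
  ππ̄≡p : π₀ *K conj π₀ ≡ ι (q (+ p))
  ππ̄≡p = |σπ|²≡p e0
  -- cong's implicit arguments are given, since unifying disc ?x with disc (piOf A B C D)
  -- would unfold the discriminant.
  disc-piOf : disc (piOf A B C D) ≡ disc π₀
  disc-piOf = cong disc {piOf A B C D} {π₀} refl
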